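{- Let $n,m\ge 2$ and suppose $x_{i,j}$ is a non-negative integer for each $i\in[n]$ and $j\in[m^2]$. For each $i\in[n]$, suppose $n_i=x_{i,1}=\cdots=x_{i,m}\le x_{i,m+1}=\cdots=x_{i,m(m-1)}\le x_{i,m(m-1)+1}=\cdots=x_{i,m^2}=n_i+1$ for some $n_i\ge 0$. Then for any permutations $\sigma_1,\ldots,\sigma_n$ of $[m^2]$, $$\sum_{j=1}^{m^2}\prod_{i=1}^n x_{i,\sigma_i(j)}\le\sum_{j=1}^{m^2}\prod_{i=1}^n x_{i,j}.$$
   Context: $[k]=\{1,\ldots,k\}$. -}

module Defs where

open import Data.Nat using (ℕ; zero; suc; _+_; _*_; _∸_; _≤_; _<_)
open import Data.Fin using (Fin; toℕ)
import Data.Fin as F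
open import Relation.Binary.PropositionalEquality using (_≡_)
open import Data.Product using (Σ; _×_)

-- Σ over Fin k (0-based indices j = 0,...,k-1 correspond to paper's 1..k)
sumFin : (k : ℕ) → (Fin k → ℕ) → ℕ
sumFin zero    f = 0
sumFin (suc k) f = f F.zero + sumFin k (λ j → f (F.suc j))

prodFin : (k : ℕ) → (Fin k → ℕ) → ℕ
prodFin zero    f = 1
prodFin (suc k) f = f F.zero * prodFin k (λ j → f (F.suc j))

-- The row shape hypothesis for a row r : [m^2] → ℕ (0-based index j ↔ paper's j+1):
-- there are nᵢ, c with nᵢ ≤ c ≤ nᵢ + 1, entries 1..m equal nᵢ,
-- entries m+1..m(m-1) equal c, entries m(m-1)+1..m^2 equal nᵢ+1.
RowShape : (m : ℕ) → (Fin (m * m) → ℕ) → Set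
RowShape m r =
  Σ ℕ λ nᵢ → Σ ℕ λ c →
    (nᵢ ≤ c) × (c ≤ suc nᵢ) ×
    ((j : Fin (m * m)) → toℕ j < m → r j ≡ nᵢ) ×
    ((j : Fin (m * m)) → m ≤ toℕ j → toℕ j < m * (m ∸ 1) → r j ≡ c) ×
    ((j : Fin (m * m)) → m * (m ∸ 1) ≤ toℕ j → r j ≡ suc nᵢ)

-- Every row is a constant aᵢ plus the indicator of a suffix {j ≥ sᵢ} of [m²], since its
-- middle block equals either nᵢ or nᵢ + 1. Expanding ∏ᵢ (aᵢ + eᵢ) over subsets S of rows,
-- each column product sum becomes Σ_S ∏_{i∉S} aᵢ · |⋂_{i∈S} Eᵢ|, where Eᵢ is the support
-- of the (possibly permuted) indicator eᵢ. Permuting a row keeps |Eᵢ|, and an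
-- intersection is never larger than its smallest member; for the unpermuted rows the
-- supports are nested suffixes, so the bound min_{i∈S} |Eᵢ| is attained.
module Submission where

open import Defs
open import Data.Nat using (ℕ; zero; suc; _+_; _*_; _∸_; _≤_; _<_; _⊓_; _⊔_; z≤n; s≤s)
open import Data.Nat.Properties
open import Data.Nat.Solver using (module +-*-Solver)
open import Data.Fin using (Fin; toℕ)
import Data.Fin as F
open import Data.Fin.Permutation using (Permutation′; _⟨$⟩ʳ_)
open import Data.Product using (∃₂; _,_; proj₁; proj₂)
open import Data.Sum using (inj₁; inj₂)
open import Relation.Binary.PropositionalEquality hiding ([_])
open import Relation.Nullary using (yes; no)
import Algebra.Properties.Semiring.Sum as SemiringSum

private
  module ∑ = SemiringSum +-*-semiring

sumFin≡sum : ∀ N (f : Fin N → ℕ) → sumFin N f ≡ ∑.sum f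
sumFin≡sum zero    f = refl
sumFin≡sum (suc N) f = cong (f F.zero +_) (sumFin≡sum N (λ j → f (F.suc j)))

sumFin-cong : ∀ N {f g : Fin N → ℕ} → (∀ j → f j ≡ g j) → sumFin N f ≡ sumFin N g
sumFin-cong zero    f≗g = refl
sumFin-cong (suc N) f≗g = cong₂ _+_ (f≗g F.zero) (sumFin-cong N (λ j → f≗g (F.suc j)))

sumFin-mono-≤ : ∀ N {f g : Fin N → ℕ} → (∀ j → f j ≤ g j) → sumFin N f ≤ sumFin N g
sumFin-mono-≤ zero    f≤g = z≤n
sumFin-mono-≤ (suc N) f≤g = +-mono-≤ (f≤g F.zero) (sumFin-mono-≤ N (λ j → f≤g (F.suc j)))

sumFin-distrib-+ : ∀ N (f g : Fin N → ℕ) →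
  sumFin N (λ j → f j + g j) ≡ sumFin N f + sumFin N g
sumFin-distrib-+ N f g = begin
  sumFin N (λ j → f j + g j)  ≡⟨ sumFin≡sum N _ ⟩
  ∑.sum (λ j → f j + g j)     ≡⟨ ∑.∑-distrib-+ f g ⟩
  ∑.sum f + ∑.sum g           ≡⟨ sym (cong₂ _+_ (sumFin≡sum N f) (sumFin≡sum N g)) ⟩
  sumFin N f + sumFin N g     ∎
  where open ≡-Reasoning

*-distribˡ-sumFin : ∀ N k (f : Fin N → ℕ) → k * sumFin N f ≡ sumFin N (λ j → k * f j)
*-distribˡ-sumFin N k f = begin
  k * sumFin N f          ≡⟨ cong (k *_) (sumFin≡sum N f) ⟩
  k * ∑.sum f             ≡⟨ ∑.*-distribˡ-sum k f ⟩
  ∑.sum (λ j → k * f j)   ≡⟨ sym (sumFin≡sum N _) ⟩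
  sumFin N (λ j → k * f j) ∎
  where open ≡-Reasoning

sumFin-permute : ∀ N (f : Fin N → ℕ) (π : Permutation′ N) →
  sumFin N (λ j → f (π ⟨$⟩ʳ j)) ≡ sumFin N f
sumFin-permute N f π = begin
  sumFin N (λ j → f (π ⟨$⟩ʳ j)) ≡⟨ sumFin≡sum N _ ⟩
  ∑.sum (λ j → f (π ⟨$⟩ʳ j))    ≡⟨ sym (∑.sum-permute f π) ⟩
  ∑.sum f                       ≡⟨ sym (sumFin≡sum N f) ⟩
  sumFin N f                    ∎
  where open ≡-Reasoning

[_≤_] : ℕ → ℕ → ℕ
[ zero  ≤ t     ] = 1
[ suc s ≤ zero  ] = 0
[ suc s ≤ suc t ] = [ s ≤ t ]

[≤]≤1 : ∀ s t → [ s ≤ t ] ≤ 1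
[≤]≤1 zero    t       = ≤-refl
[≤]≤1 (suc s) zero    = z≤n
[≤]≤1 (suc s) (suc t) = [≤]≤1 s t

[≤]≡0 : ∀ {s t} → t < s → [ s ≤ t ] ≡ 0
[≤]≡0 {suc s} {zero}  _         = refl
[≤]≡0 {suc s} {suc t} (s≤s t<s) = [≤]≡0 t<s

[≤]≡1 : ∀ {s t} → s ≤ t → [ s ≤ t ] ≡ 1
[≤]≡1 {zero}  _         = refl
[≤]≡1 {suc s} (s≤s s≤t) = [≤]≡1 s≤t

[≤]-*-[≤] : ∀ p s t → [ p ≤ t ] * [ s ≤ t ] ≡ [ p ⊔ s ≤ t ]
[≤]-*-[≤] zero    s       t       = +-identityʳ [ s ≤ t ]
[≤]-*-[≤] (suc p) zero    zero    = refl
[≤]-*-[≤] (suc p) zero    (suc t) = *-identityʳ [ p ≤ t ]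
[≤]-*-[≤] (suc p) (suc s) zero    = refl
[≤]-*-[≤] (suc p) (suc s) (suc t) = [≤]-*-[≤] p s t

sumFin-[≤] : ∀ N s → sumFin N (λ j → [ s ≤ toℕ j ]) ≡ N ∸ s
sumFin-[≤] zero    zero    = refl
sumFin-[≤] zero    (suc s) = refl
sumFin-[≤] (suc N) zero    = cong suc (sumFin-[≤] N zero)
sumFin-[≤] (suc N) (suc s) = sumFin-[≤] N s

≡+[≤] : ∀ {N} (r : Fin N → ℕ) a s →
  (∀ j → toℕ j < s → r j ≡ a) → (∀ j → s ≤ toℕ j → r j ≡ suc a) →
  ∀ j → r j ≡ a + [ s ≤ toℕ j ]
≡+[≤] r a s below above j with toℕ j <? s
... | yes j<s = trans (below j j<s) (sym (trans (cong (a +_) ([≤]≡0 j<s)) (+-identityʳ a)))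
... | no  j≮s = trans (above j s≤j) (sym (trans (cong (a +_) ([≤]≡1 s≤j)) (+-comm a 1)))
  where s≤j = ≮⇒≥ j≮s

RowShape⇒≡+[≤] : ∀ m (r : Fin (m * m) → ℕ) → RowShape m r →
  ∃₂ λ a s → ∀ j → r j ≡ a + [ s ≤ toℕ j ]
RowShape⇒≡+[≤] m r (a , c , a≤c , c≤1+a , first , middle , last)
  with m≤n⇒m<n∨m≡n c≤1+a
... | inj₁ (s≤s c≤a) = a , m * (m ∸ 1) , ≡+[≤] r a _ below last
  where
  below : ∀ j → toℕ j < m * (m ∸ 1) → r j ≡ a
  below j j<s with toℕ j <? m
  ... | yes j<m = first j j<m
  ... | no  j≮m = trans (middle j (≮⇒≥ j≮m) j<s) (≤-antisym c≤a a≤c)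
... | inj₂ c≡1+a = a , m , ≡+[≤] r a m first above
  where
  above : ∀ j → m ≤ toℕ j → r j ≡ suc a
  above j m≤j with toℕ j <? m * (m ∸ 1)
  ... | yes j<s = trans (middle j m≤j j<s) c≡1+a
  ... | no  j≮s = last j (≮⇒≥ j≮s)

columnProductSum : ∀ N k → (Fin k → Fin N → ℕ) → (Fin N → ℕ) → ℕ
columnProductSum N k z ψ = sumFin N (λ j → ψ j * prodFin k (λ i → z i j))

-- intersectionBound k a c q = Σ_{S ⊆ [k]} ∏_{i∉S} aᵢ · min (q , min_{i∈S} cᵢ)
intersectionBound : ∀ k → (Fin k → ℕ) → (Fin k → ℕ) → ℕ → ℕ
intersectionBound zero    a c q = q
intersectionBound (suc k) a c q =
  a F.zero * intersectionBound k (λ i → a (F.suc i)) (λ i → c (F.suc i)) q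
  + intersectionBound k (λ i → a (F.suc i)) (λ i → c (F.suc i)) (q ⊓ c F.zero)

intersectionBound-mono-≤ : ∀ k a c {q q′} → q ≤ q′ →
  intersectionBound k a c q ≤ intersectionBound k a c q′
intersectionBound-mono-≤ zero    a c q≤q′ = q≤q′
intersectionBound-mono-≤ (suc k) a c q≤q′ =
  +-mono-≤ (*-monoʳ-≤ (a F.zero) (intersectionBound-mono-≤ k _ _ q≤q′))
           (intersectionBound-mono-≤ k _ _ (⊓-monoˡ-≤ (c F.zero) q≤q′))

columnProductSum-split : ∀ N k a (e : Fin N → ℕ) (z : Fin (suc k) → Fin N → ℕ) ψ →
  (∀ j → z F.zero j ≡ a + e j) →
  columnProductSum N (suc k) z ψ
    ≡ a * columnProductSum N k (λ i → z (F.suc i)) ψ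
      + columnProductSum N k (λ i → z (F.suc i)) (λ j → ψ j * e j)
columnProductSum-split N k a e z ψ z₀≡a+e = begin
  sumFin N (λ j → ψ j * (z F.zero j * P j))
    ≡⟨ sumFin-cong N (λ j → cong (λ t → ψ j * (t * P j)) (z₀≡a+e j)) ⟩
  sumFin N (λ j → ψ j * ((a + e j) * P j))
    ≡⟨ sumFin-cong N (λ j → expand a (ψ j) (e j) (P j)) ⟩
  sumFin N (λ j → a * (ψ j * P j) + ψ j * e j * P j)
    ≡⟨ sumFin-distrib-+ N _ _ ⟩
  sumFin N (λ j → a * (ψ j * P j)) + sumFin N (λ j → ψ j * e j * P j)
    ≡⟨ cong (_+ sumFin N (λ j → ψ j * e j * P j)) (sym (*-distribˡ-sumFin N a _)) ⟩
  a * sumFin N (λ j → ψ j * P j) + sumFin N (λ j → ψ j * e j * P j) ∎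
  where
  open ≡-Reasoning
  P : Fin N → ℕ
  P j = prodFin k (λ i → z (F.suc i) j)
  open +-*-Solver
  expand : ∀ a x y p → x * ((a + y) * p) ≡ a * (x * p) + x * y * p
  expand = solve 4 (λ a x y p → x :* ((a :+ y) :* p) := a :* (x :* p) :+ x :* y :* p) refl

-- ψ is the indicator of the intersection of the supports already peeled off.
columnProductSum≤intersectionBound :
  ∀ N k (a c : Fin k → ℕ) (e z : Fin k → Fin N → ℕ) →
  (∀ i j → e i j ≤ 1) → (∀ i → sumFin N (e i) ≤ c i) →
  (∀ i j → z i j ≡ a i + e i j) →
  (ψ : Fin N → ℕ) → (∀ j → ψ j ≤ 1) →
  columnProductSum N k z ψ ≤ intersectionBound k a c (sumFin N ψ)
columnProductSum≤intersectionBound N zero a c e z e≤1 Σe≤c z≡a+e ψ ψ≤1 =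
  ≤-reflexive (sumFin-cong N (λ j → *-identityʳ (ψ j)))
columnProductSum≤intersectionBound N (suc k) a c e z e≤1 Σe≤c z≡a+e ψ ψ≤1 = begin
  columnProductSum N (suc k) z ψ
    ≡⟨ columnProductSum-split N k (a F.zero) (e F.zero) z ψ (z≡a+e F.zero) ⟩
  a F.zero * columnProductSum N k z′ ψ + columnProductSum N k z′ ψe
    ≤⟨ +-mono-≤ (*-monoʳ-≤ (a F.zero) (induction ψ ψ≤1)) (induction ψe ψe≤1) ⟩
  a F.zero * intersectionBound k a′ c′ (sumFin N ψ) + intersectionBound k a′ c′ (sumFin N ψe)
    ≤⟨ +-monoʳ-≤ _ (intersectionBound-mono-≤ k a′ c′ (⊓-glb Σψe≤Σψ Σψe≤c₀)) ⟩
  intersectionBound (suc k) a c (sumFin N ψ) ∎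
  where
  open ≤-Reasoning
  a′ = λ i → a (F.suc i)
  c′ = λ i → c (F.suc i)
  z′ = λ i → z (F.suc i)
  ψe = λ j → ψ j * e F.zero j
  ψe≤ψ : ∀ j → ψe j ≤ ψ j
  ψe≤ψ j = ≤-trans (*-monoʳ-≤ (ψ j) (e≤1 F.zero j)) (≤-reflexive (*-identityʳ (ψ j)))
  ψe≤e : ∀ j → ψe j ≤ e F.zero j
  ψe≤e j = ≤-trans (*-monoˡ-≤ (e F.zero j) (ψ≤1 j)) (≤-reflexive (+-identityʳ (e F.zero j)))
  ψe≤1 : ∀ j → ψe j ≤ 1
  ψe≤1 j = ≤-trans (ψe≤ψ j) (ψ≤1 j)
  Σψe≤Σψ = sumFin-mono-≤ N ψe≤ψ
  Σψe≤c₀ = ≤-trans (sumFin-mono-≤ N ψe≤e) (Σe≤c F.zero)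
  induction : ∀ φ → (∀ j → φ j ≤ 1) →
    columnProductSum N k z′ φ ≤ intersectionBound k a′ c′ (sumFin N φ)
  induction = columnProductSum≤intersectionBound N k a′ c′ (λ i → e (F.suc i)) z′
    (λ i → e≤1 (F.suc i)) (λ i → Σe≤c (F.suc i)) (λ i → z≡a+e (F.suc i))

intersectionBound≤columnProductSum-suffixes :
  ∀ N k (a s : Fin k → ℕ) (z : Fin k → Fin N → ℕ) →
  (∀ i j → z i j ≡ a i + [ s i ≤ toℕ j ]) →
  ∀ p → intersectionBound k a (λ i → N ∸ s i) (N ∸ p)
        ≤ columnProductSum N k z (λ j → [ p ≤ toℕ j ])
intersectionBound≤columnProductSum-suffixes N zero a s z z≡a+[s≤] p =
  ≤-reflexive (sym (trans (sumFin-cong N (λ j → *-identityʳ _)) (sumFin-[≤] N p)))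
intersectionBound≤columnProductSum-suffixes N (suc k) a s z z≡a+[s≤] p = begin
  intersectionBound (suc k) a (λ i → N ∸ s i) (N ∸ p)
    ≡⟨ cong (λ q → a F.zero * intersectionBound k a′ c′ (N ∸ p) + intersectionBound k a′ c′ q)
            (sym (∸-distribˡ-⊔-⊓ N p (s F.zero))) ⟩
  a F.zero * intersectionBound k a′ c′ (N ∸ p) + intersectionBound k a′ c′ (N ∸ (p ⊔ s F.zero))
    ≤⟨ +-mono-≤ (*-monoʳ-≤ (a F.zero) (induction p)) (induction (p ⊔ s F.zero)) ⟩
  a F.zero * columnProductSum N k z′ ψ + columnProductSum N k z′ (λ j → [ p ⊔ s F.zero ≤ toℕ j ])
    ≡⟨ cong (a F.zero * columnProductSum N k z′ ψ +_) (sumFin-cong N (λ j →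
         cong (_* prodFin k (λ i → z′ i j)) (sym ([≤]-*-[≤] p (s F.zero) (toℕ j))))) ⟩
  a F.zero * columnProductSum N k z′ ψ + columnProductSum N k z′ (λ j → ψ j * [ s F.zero ≤ toℕ j ])
    ≡⟨ sym (columnProductSum-split N k (a F.zero) _ z ψ (z≡a+[s≤] F.zero)) ⟩
  columnProductSum N (suc k) z ψ ∎
  where
  open ≤-Reasoning
  a′ = λ i → a (F.suc i)
  c′ = λ i → N ∸ s (F.suc i)
  z′ = λ i → z (F.suc i)
  ψ = λ j → [ p ≤ toℕ j ]
  induction : ∀ q → intersectionBound k a′ c′ (N ∸ q) ≤ columnProductSum N k z′ (λ j → [ q ≤ toℕ j ])
  induction = intersectionBound≤columnProductSum-suffixes N k a′ (λ i → s (F.suc i)) z′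
    (λ i → z≡a+[s≤] (F.suc i))

mainTheorem10 : (n m : ℕ) → 2 ≤ n → 2 ≤ m →
    (x : Fin n → Fin (m * m) → ℕ) →
    ((i : Fin n) → RowShape m (x i)) →
    (σ : Fin n → Permutation′ (m * m)) →
    sumFin (m * m) (λ j → prodFin n (λ i → x i (σ i ⟨$⟩ʳ j)))
      ≤ sumFin (m * m) (λ j → prodFin n (λ i → x i j))
mainTheorem10 n m _ _ x shaped σ = begin
  sumFin N (λ j → prodFin n (λ i → x i (σ i ⟨$⟩ʳ j)))
    ≡⟨ sumFin-cong N (λ j → sym (*-identityˡ _)) ⟩
  columnProductSum N n (λ i j → x i (σ i ⟨$⟩ʳ j)) (λ _ → 1)
    ≤⟨ columnProductSum≤intersectionBound N n a c (λ i j → [ s i ≤ toℕ (σ i ⟨$⟩ʳ j) ]) _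
         (λ i j → [≤]≤1 (s i) _) Σe≤c (λ i j → x≡a+[s≤] i (σ i ⟨$⟩ʳ j)) _ (λ _ → ≤-refl) ⟩
  intersectionBound n a c (sumFin N (λ _ → 1))
    ≡⟨ cong (intersectionBound n a c) (sumFin-[≤] N 0) ⟩
  intersectionBound n a c N
    ≤⟨ intersectionBound≤columnProductSum-suffixes N n a s x x≡a+[s≤] 0 ⟩
  columnProductSum N n x (λ _ → 1)
    ≡⟨ sumFin-cong N (λ j → *-identityˡ _) ⟩
  sumFin N (λ j → prodFin n (λ i → x i j)) ∎
  where
  open ≤-Reasoning
  N = m * m
  row : ∀ i → ∃₂ λ aᵢ sᵢ → ∀ j → x i j ≡ aᵢ + [ sᵢ ≤ toℕ j ]
  row i = RowShape⇒≡+[≤] m (x i) (shaped i)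
  a s : Fin n → ℕ
  a i = proj₁ (row i)
  s i = proj₁ (proj₂ (row i))
  x≡a+[s≤] : ∀ i j → x i j ≡ a i + [ s i ≤ toℕ j ]
  x≡a+[s≤] i = proj₂ (proj₂ (row i))
  c : Fin n → ℕ
  c i = N ∸ s i
  Σe≤c : ∀ i → sumFin N (λ j → [ s i ≤ toℕ (σ i ⟨$⟩ʳ j) ]) ≤ c i
  Σe≤c i = ≤-reflexive (trans (sumFin-permute N _ (σ i)) (sumFin-[≤] N (s i)))
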